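{- Let $k\in\mathbb{N}$, $s\in T$, and let $t'$ be a tile at position $w=w_0w_1\cdots w_{k-1}\in\Sigma^k$ within the supertile $\sigma^k(s)$. Then $[t']=[s]\cdot[w_0][w_1]\cdots[w_{k-1}]$ (computed in $\mathbb{F}_p$), with the empty product equal to $I_3$.
   Context: Let $p$ be an odd prime and $\mathbb{F}_p$ the field with $p$ elements. A tile is a unit equilateral triangle of the standard triangular lattice, oriented upward or downward, whose corners are decorated with elements of $\mathbb{F}_p$. $\triangle(x,y,z)$ is the upward tile with bottom-left, bottom-right, top corners $x,y,z$; $\triangledown(x,y,z)$ the downward tile with top-right, top-left, bottom corners $x,y,z$; $T$ is the set of all such tiles. For a tile we write $[\triangle(x,y,z)]=[\triangledown(x,y,z)]=[x\ y\ z]$ (a row vector). The substitution $\sigma$ inflates a tile by factor $2$ and replaces it by four unit tiles: $\sigma(\triangle(x,y,z))$ consists of bottom-left $\triangle(x,x+y,x+z)$, bottom-right $\triangle(x+y,y,y+z)$, top $\triangle(x+z,y+z,z)$ and central $\triangledown(y+z,x+z,x+y)$; $\sigma(\triangledown(x,y,z))$ consists of top-right $\triangledown(x,x+y,x+z)$, top-left $\triangledown(x+y,y,y+z)$, bottom $\triangledown(x+z,y+z,z)$ and central $\triangle(y+z,x+z,x+y)$. $\sigma$ acts on patches tile by tile, so $\sigma^{k+1}(s)$ is the union of four $k$-supertiles $\sigma^k(u)$, $u$ ranging over the four tiles of $\sigma(s)$. Let $\Sigma=\{\alpha,\beta,\gamma,\delta\}$. Within an upward $(k+1)$-supertile, the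 central, bottom-left, bottom-right and top $k$-supertiles have positions $\alpha,\beta,\gamma,\delta$ respectively; within a downward one, the central, top-right, top-left and bottom $k$-supertiles have positions $\alpha,\beta,\gamma,\delta$. The position of a tile $t'$ within a $k$-supertile is the word $w\in\Sigma^k$ such that for each $n\in\{0,\dots,k-1\}$, $w_n$ is the position of the $(k-n-1)$-supertile containing $t'$ within the $(k-n)$-supertile containing $t'$. Set $[\alpha]=A=\begin{bmatrix}0&1&1\\1&0&1\\1&1&0\end{bmatrix}$, $[\beta]=B=\begin{bmatrix}1&1&1\\0&1&0\\0&0&1\end{bmatrix}$, $[\gamma]=C=\begin{bmatrix}1&0&0\\1&1&1\\0&0&1\end{bmatrix}$, $[\delta]=D=\begin{bmatrix}1&0&0\\0&1&0\\1&1&1\end{bmatrix}$. -}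

module Defs where

open import Data.Nat as ℕ using (ℕ; NonZero)
open import Data.Nat.DivMod using (_mod_)
open import Data.Fin using (Fin; toℕ)
open import Data.Vec using (Vec; []; _∷_; map; zipWith; foldr; replicate; transpose)
open import Data.List using (List; [])
import Data.List as List

module Field (p : ℕ) .{{_ : NonZero p}} where

  F : Set
  F = Fin p

  _+F_ : F → F → F
  x +F y = (toℕ x ℕ.+ toℕ y) mod p

  _*F_ : F → F → F
  x *F y = (toℕ x ℕ.* toℕ y) mod p

  0F 1F : F
  0F = 0 mod p
  1F = 1 mod p

  infixl 6 _+F_
  infixl 7 _*F_

  Row : Set
  Row = Vec F 3

  Mat : Set
  Mat = Vec Row 3

  dot : ∀ {n} → Vec F n → Vec F n → F
  dot u v = foldr _ _+F_ 0F (zipWith _*F_ u v)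

  _·ᵥ_ : Row → Mat → Row
  v ·ᵥ M = map (dot v) (transpose M)

  _·ₘ_ : Mat → Mat → Mat
  M ·ₘ N = map (_·ᵥ N) M

  I₃ : Mat
  I₃ = (1F ∷ 0F ∷ 0F ∷ []) ∷ (0F ∷ 1F ∷ 0F ∷ []) ∷ (0F ∷ 0F ∷ 1F ∷ []) ∷ []

  -- Tiles: an orientation and three corner labels.
  --   up   x y z  = △(x,y,z): bottom-left, bottom-right, top
  --   down x y z  = ▽(x,y,z): top-right, top-left, bottom

  data Tile : Set where
    up   : F → F → F → Tile
    down : F → F → F → Tile

  ⟦_⟧ : Tile → Row
  ⟦ up x y z ⟧   = x ∷ y ∷ z ∷ []
  ⟦ down x y z ⟧ = x ∷ y ∷ z ∷ []

  data Σ : Set where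
    α β γ δ : Σ

  -- The tile of σ(s) at a given position (positions as in the paper:
  -- upward: α central, β bottom-left, γ bottom-right, δ top;
  -- downward: α central, β top-right, γ top-left, δ bottom).
  child : Tile → Σ → Tile
  child (up x y z) α   = down (y +F z) (x +F z) (x +F y)
  child (up x y z) β   = up x (x +F y) (x +F z)
  child (up x y z) γ   = up (x +F y) y (y +F z)
  child (up x y z) δ   = up (x +F z) (y +F z) z
  child (down x y z) α = up (y +F z) (x +F z) (x +F y)
  child (down x y z) β = down x (x +F y) (x +F z)
  child (down x y z) γ = down (x +F y) y (y +F z)
  child (down x y z) δ = down (x +F z) (y +F z) z

  -- The tile at position w = w₀ w₁ … w_{k-1} within the supertile σ^k(s):
  -- w₀ selects the (k-1)-supertile σ^{k-1}(child s w₀) of σ^k(s), and so on.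
  tileAt : ∀ {k} → Tile → Vec Σ k → Tile
  tileAt s []      = s
  tileAt s (a ∷ w) = tileAt (child s a) w

  ⟦_⟧Σ : Σ → Mat
  ⟦ α ⟧Σ = (0F ∷ 1F ∷ 1F ∷ []) ∷ (1F ∷ 0F ∷ 1F ∷ []) ∷ (1F ∷ 1F ∷ 0F ∷ []) ∷ []
  ⟦ β ⟧Σ = (1F ∷ 1F ∷ 1F ∷ []) ∷ (0F ∷ 1F ∷ 0F ∷ []) ∷ (0F ∷ 0F ∷ 1F ∷ []) ∷ []
  ⟦ γ ⟧Σ = (1F ∷ 0F ∷ 0F ∷ []) ∷ (1F ∷ 1F ∷ 1F ∷ []) ∷ (0F ∷ 0F ∷ 1F ∷ []) ∷ []
  ⟦ δ ⟧Σ = (1F ∷ 0F ∷ 0F ∷ []) ∷ (0F ∷ 1F ∷ 0F ∷ []) ∷ (1F ∷ 1F ∷ 1F ∷ []) ∷ []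

  ⟦_⟧* : ∀ {k} → Vec Σ k → Mat
  ⟦ [] ⟧*    = I₃
  ⟦ a ∷ w ⟧* = ⟦ a ⟧Σ ·ₘ ⟦ w ⟧*

-- Reading the corner labels of a child tile off those of its parent is
-- linear: the child at position a has labels [s]·[a], whatever the
-- orientation of s. Unfolding tileAt one position at a time and using
-- associativity of the vector–matrix product gives [s]·[w₀]⋯[w_{k-1}].
-- Nothing beyond p ≠ 0 is used: the statement holds in every ℤ/pℤ.
module Submission where

open import Defs
open import Algebra.Bundles using (CommutativeSemiring)
open import Algebra.Structures using (IsCommutativeMonoid)
open import Algebra.Structures.Biased using (isCommutativeMonoidˡ; isCommutativeSemiringˡ)
open import Data.Fin using (toℕ)
open import Data.Fin.Properties using (fromℕ<-cong; fromℕ<-toℕ; toℕ-fromℕ<; toℕ<n)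
open import Data.Nat using (ℕ; NonZero; _+_; _*_; _%_)
import Data.Nat.Properties as ℕ
open import Data.Nat.DivMod using (_mod_; m%n<n; m<n⇒m%n≡m; %-distribˡ-+; %-distribˡ-*)
open import Data.Nat.Divisibility using (_∣_)
open import Data.Nat.Primality using (Prime)
open import Data.Vec using (Vec; []; _∷_)
open import Relation.Binary.PropositionalEquality
  using (_≡_; refl; sym; trans; cong; cong₂; subst; module ≡-Reasoning)
open import Relation.Binary.PropositionalEquality.Algebra using (isMagma)
open import Relation.Nullary using (¬_)

module ModularArithmetic (p : ℕ) .{{_ : NonZero p}} where
  open Field p
  open ≡-Reasoning

  [_] : ℕ → F
  [ a ] = a mod p

  toℕ-mod : ∀ a → toℕ [ a ] ≡ a % p
  toℕ-mod a = toℕ-fromℕ< (m%n<n a p)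

  mod-cong : ∀ {a b} → a % p ≡ b % p → [ a ] ≡ [ b ]
  mod-cong e = fromℕ<-cong _ _ e _ _

  mod-toℕ : ∀ x → [ toℕ x ] ≡ x
  mod-toℕ x = trans (fromℕ<-cong _ _ (m<n⇒m%n≡m (toℕ<n x)) _ (toℕ<n x)) (fromℕ<-toℕ x (toℕ<n x))

  mod-+ : ∀ a b → [ a + b ] ≡ [ a ] +F [ b ]
  mod-+ a b = mod-cong (trans (%-distribˡ-+ a b p)
    (cong₂ (λ m n → (m + n) % p) (sym (toℕ-mod a)) (sym (toℕ-mod b))))

  mod-* : ∀ a b → [ a * b ] ≡ [ a ] *F [ b ]
  mod-* a b = mod-cong (trans (%-distribˡ-* a b p)
    (cong₂ (λ m n → (m * n) % p) (sym (toℕ-mod a)) (sym (toℕ-mod b))))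

  -- [_] is a surjective homomorphism from ℕ, so the laws of F need only be
  -- checked on residues [ a ], where they are inherited from ℕ.
  mod-elim₁ : {P : F → Set} → (∀ a → P [ a ]) → ∀ x → P x
  mod-elim₁ {P} h x = subst P (mod-toℕ x) (h (toℕ x))

  mod-elim₃ : {P : F → F → F → Set} → (∀ a b c → P [ a ] [ b ] [ c ]) →
              ∀ x y z → P x y z
  mod-elim₃ {P} h x y z =
    subst (λ x → P x y z) (mod-toℕ x)
      (subst (λ y → P _ y z) (mod-toℕ y)
        (subst (P _ _) (mod-toℕ z) (h (toℕ x) (toℕ y) (toℕ z))))

  +F-assoc : ∀ x y z → (x +F y) +F z ≡ x +F (y +F z)
  +F-assoc = mod-elim₃ λ a b c → begin
    ([ a ] +F [ b ]) +F [ c ]  ≡⟨ cong (_+F [ c ]) (mod-+ a b) ⟨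
    [ a + b ] +F [ c ]         ≡⟨ mod-+ (a + b) c ⟨
    [ a + b + c ]              ≡⟨ cong [_] (ℕ.+-assoc a b c) ⟩
    [ a + (b + c) ]            ≡⟨ mod-+ a (b + c) ⟩
    [ a ] +F [ b + c ]         ≡⟨ cong ([ a ] +F_) (mod-+ b c) ⟩
    [ a ] +F ([ b ] +F [ c ])  ∎

  *F-assoc : ∀ x y z → (x *F y) *F z ≡ x *F (y *F z)
  *F-assoc = mod-elim₃ λ a b c → begin
    ([ a ] *F [ b ]) *F [ c ]  ≡⟨ cong (_*F [ c ]) (mod-* a b) ⟨
    [ a * b ] *F [ c ]         ≡⟨ mod-* (a * b) c ⟨
    [ a * b * c ]              ≡⟨ cong [_] (ℕ.*-assoc a b c) ⟩
    [ a * (b * c) ]            ≡⟨ mod-* a (b * c) ⟩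
    [ a ] *F [ b * c ]         ≡⟨ cong ([ a ] *F_) (mod-* b c) ⟩
    [ a ] *F ([ b ] *F [ c ])  ∎

  *F-distribʳ-+F : ∀ x y z → (y +F z) *F x ≡ y *F x +F z *F x
  *F-distribʳ-+F = mod-elim₃ λ a b c → begin
    ([ b ] +F [ c ]) *F [ a ]         ≡⟨ cong (_*F [ a ]) (mod-+ b c) ⟨
    [ b + c ] *F [ a ]                ≡⟨ mod-* (b + c) a ⟨
    [ (b + c) * a ]                   ≡⟨ cong [_] (ℕ.*-distribʳ-+ a b c) ⟩
    [ b * a + c * a ]                 ≡⟨ mod-+ (b * a) (c * a) ⟩
    [ b * a ] +F [ c * a ]            ≡⟨ cong₂ _+F_ (mod-* b a) (mod-* c a) ⟩
    [ b ] *F [ a ] +F [ c ] *F [ a ]  ∎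

  +F-comm : ∀ x y → x +F y ≡ y +F x
  +F-comm x y = cong [_] (ℕ.+-comm (toℕ x) (toℕ y))

  *F-comm : ∀ x y → x *F y ≡ y *F x
  *F-comm x y = cong [_] (ℕ.*-comm (toℕ x) (toℕ y))

  +F-identityˡ : ∀ x → 0F +F x ≡ x
  +F-identityˡ = mod-elim₁ λ a → sym (mod-+ 0 a)

  *F-identityˡ : ∀ x → 1F *F x ≡ x
  *F-identityˡ = mod-elim₁ λ a → trans (sym (mod-* 1 a)) (cong [_] (ℕ.*-identityˡ a))

  *F-zeroˡ : ∀ x → 0F *F x ≡ 0F
  *F-zeroˡ = mod-elim₁ λ a → sym (mod-* 0 a)

  +F-isCommutativeMonoid : IsCommutativeMonoid _≡_ _+F_ 0F
  +F-isCommutativeMonoid = isCommutativeMonoidˡ record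
    { isSemigroup = record { isMagma = isMagma _+F_ ; assoc = +F-assoc }
    ; identityˡ   = +F-identityˡ
    ; comm        = +F-comm
    }

  *F-isCommutativeMonoid : IsCommutativeMonoid _≡_ _*F_ 1F
  *F-isCommutativeMonoid = isCommutativeMonoidˡ record
    { isSemigroup = record { isMagma = isMagma _*F_ ; assoc = *F-assoc }
    ; identityˡ   = *F-identityˡ
    ; comm        = *F-comm
    }

  commutativeSemiring : CommutativeSemiring _ _
  commutativeSemiring = record
    { isCommutativeSemiring = isCommutativeSemiringˡ record
      { +-isCommutativeMonoid = +F-isCommutativeMonoid
      ; *-isCommutativeMonoid = *F-isCommutativeMonoid
      ; distribʳ              = *F-distribʳ-+F
      ; zeroˡ                 = *F-zeroˡ
      }
    }

module Tiling (p : ℕ) .{{_ : NonZero p}} where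
  open Field p
  open ModularArithmetic p using (commutativeSemiring)
  open import Algebra.Solver.Ring.NaturalCoefficients.Default commutativeSemiring
    using (solve; _:=_; Polynomial; _:+_; _:*_; con)
  open ≡-Reasoning

  private
    dotₚ : ∀ {n} → Polynomial n → Polynomial n → Polynomial n →
           Polynomial n → Polynomial n → Polynomial n → Polynomial n
    dotₚ x y z a b c = x :* a :+ (y :* b :+ (z :* c :+ con 0))

    row-cong : ∀ {a b c a′ b′ c′ : F} → a ≡ a′ → b ≡ b′ → c ≡ c′ →
               (a ∷ b ∷ c ∷ []) ≡ (a′ ∷ b′ ∷ c′ ∷ [])
    row-cong a≡a′ b≡b′ c≡c′ = cong₂ _∷_ a≡a′ (cong₂ _∷_ b≡b′ (cong₂ _∷_ c≡c′ refl))

  ·ᵥ-·ₘ-assoc : ∀ v M N → v ·ᵥ (M ·ₘ N) ≡ (v ·ᵥ M) ·ᵥ N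
  ·ᵥ-·ₘ-assoc (x ∷ y ∷ z ∷ [])
              ((m₀₀ ∷ m₀₁ ∷ m₀₂ ∷ []) ∷ (m₁₀ ∷ m₁₁ ∷ m₁₂ ∷ []) ∷ (m₂₀ ∷ m₂₁ ∷ m₂₂ ∷ []) ∷ [])
              ((n₀₀ ∷ n₀₁ ∷ n₀₂ ∷ []) ∷ (n₁₀ ∷ n₁₁ ∷ n₁₂ ∷ []) ∷ (n₂₀ ∷ n₂₁ ∷ n₂₂ ∷ []) ∷ []) =
    row-cong (column n₀₀ n₁₀ n₂₀) (column n₀₁ n₁₁ n₂₁) (column n₀₂ n₁₂ n₂₂)
    where
    column : ∀ a b c →
      dot (x ∷ y ∷ z ∷ []) (dot (m₀₀ ∷ m₀₁ ∷ m₀₂ ∷ []) (a ∷ b ∷ c ∷ [])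
                          ∷ dot (m₁₀ ∷ m₁₁ ∷ m₁₂ ∷ []) (a ∷ b ∷ c ∷ [])
                          ∷ dot (m₂₀ ∷ m₂₁ ∷ m₂₂ ∷ []) (a ∷ b ∷ c ∷ []) ∷ [])
      ≡ dot (dot (x ∷ y ∷ z ∷ []) (m₀₀ ∷ m₁₀ ∷ m₂₀ ∷ [])
           ∷ dot (x ∷ y ∷ z ∷ []) (m₀₁ ∷ m₁₁ ∷ m₂₁ ∷ [])
           ∷ dot (x ∷ y ∷ z ∷ []) (m₀₂ ∷ m₁₂ ∷ m₂₂ ∷ []) ∷ []) (a ∷ b ∷ c ∷ [])
    column = solve 15
      (λ x y z m₀₀ m₀₁ m₀₂ m₁₀ m₁₁ m₁₂ m₂₀ m₂₁ m₂₂ a b c →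
        dotₚ x y z (dotₚ m₀₀ m₀₁ m₀₂ a b c) (dotₚ m₁₀ m₁₁ m₁₂ a b c) (dotₚ m₂₀ m₂₁ m₂₂ a b c)
        := dotₚ (dotₚ x y z m₀₀ m₁₀ m₂₀) (dotₚ x y z m₀₁ m₁₁ m₂₁) (dotₚ x y z m₀₂ m₁₂ m₂₂) a b c)
      refl x y z m₀₀ m₀₁ m₀₂ m₁₀ m₁₁ m₁₂ m₂₀ m₂₁ m₂₂

  dot-100 : ∀ x y z → dot (x ∷ y ∷ z ∷ []) (1F ∷ 0F ∷ 0F ∷ []) ≡ x
  dot-100 = solve 3 (λ x y z → dotₚ x y z (con 1) (con 0) (con 0) := x) refl

  dot-010 : ∀ x y z → dot (x ∷ y ∷ z ∷ []) (0F ∷ 1F ∷ 0F ∷ []) ≡ y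
  dot-010 = solve 3 (λ x y z → dotₚ x y z (con 0) (con 1) (con 0) := y) refl

  dot-001 : ∀ x y z → dot (x ∷ y ∷ z ∷ []) (0F ∷ 0F ∷ 1F ∷ []) ≡ z
  dot-001 = solve 3 (λ x y z → dotₚ x y z (con 0) (con 0) (con 1) := z) refl

  dot-011 : ∀ x y z → dot (x ∷ y ∷ z ∷ []) (0F ∷ 1F ∷ 1F ∷ []) ≡ y +F z
  dot-011 = solve 3 (λ x y z → dotₚ x y z (con 0) (con 1) (con 1) := y :+ z) refl

  dot-101 : ∀ x y z → dot (x ∷ y ∷ z ∷ []) (1F ∷ 0F ∷ 1F ∷ []) ≡ x +F z
  dot-101 = solve 3 (λ x y z → dotₚ x y z (con 1) (con 0) (con 1) := x :+ z) refl

  dot-110 : ∀ x y z → dot (x ∷ y ∷ z ∷ []) (1F ∷ 1F ∷ 0F ∷ []) ≡ x +F y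
  dot-110 = solve 3 (λ x y z → dotₚ x y z (con 1) (con 1) (con 0) := x :+ y) refl

  ·ᵥ-identityʳ : ∀ v → v ·ᵥ I₃ ≡ v
  ·ᵥ-identityʳ (x ∷ y ∷ z ∷ []) = row-cong (dot-100 x y z) (dot-010 x y z) (dot-001 x y z)

  ·ᵥ-⟦α⟧ : ∀ x y z → (x ∷ y ∷ z ∷ []) ·ᵥ ⟦ α ⟧Σ ≡ (y +F z ∷ x +F z ∷ x +F y ∷ [])
  ·ᵥ-⟦α⟧ x y z = row-cong (dot-011 x y z) (dot-101 x y z) (dot-110 x y z)

  ·ᵥ-⟦β⟧ : ∀ x y z → (x ∷ y ∷ z ∷ []) ·ᵥ ⟦ β ⟧Σ ≡ (x ∷ x +F y ∷ x +F z ∷ [])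
  ·ᵥ-⟦β⟧ x y z = row-cong (dot-100 x y z) (dot-110 x y z) (dot-101 x y z)

  ·ᵥ-⟦γ⟧ : ∀ x y z → (x ∷ y ∷ z ∷ []) ·ᵥ ⟦ γ ⟧Σ ≡ (x +F y ∷ y ∷ y +F z ∷ [])
  ·ᵥ-⟦γ⟧ x y z = row-cong (dot-110 x y z) (dot-010 x y z) (dot-011 x y z)

  ·ᵥ-⟦δ⟧ : ∀ x y z → (x ∷ y ∷ z ∷ []) ·ᵥ ⟦ δ ⟧Σ ≡ (x +F z ∷ y +F z ∷ z ∷ [])
  ·ᵥ-⟦δ⟧ x y z = row-cong (dot-101 x y z) (dot-011 x y z) (dot-001 x y z)

  ⟦child⟧ : ∀ s a → ⟦ child s a ⟧ ≡ ⟦ s ⟧ ·ᵥ ⟦ a ⟧Σ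
  ⟦child⟧ (up x y z)   α = sym (·ᵥ-⟦α⟧ x y z)
  ⟦child⟧ (up x y z)   β = sym (·ᵥ-⟦β⟧ x y z)
  ⟦child⟧ (up x y z)   γ = sym (·ᵥ-⟦γ⟧ x y z)
  ⟦child⟧ (up x y z)   δ = sym (·ᵥ-⟦δ⟧ x y z)
  ⟦child⟧ (down x y z) α = sym (·ᵥ-⟦α⟧ x y z)
  ⟦child⟧ (down x y z) β = sym (·ᵥ-⟦β⟧ x y z)
  ⟦child⟧ (down x y z) γ = sym (·ᵥ-⟦γ⟧ x y z)
  ⟦child⟧ (down x y z) δ = sym (·ᵥ-⟦δ⟧ x y z)

  ⟦tileAt⟧ : ∀ {k} s (w : Vec Σ k) → ⟦ tileAt s w ⟧ ≡ ⟦ s ⟧ ·ᵥ ⟦ w ⟧*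
  ⟦tileAt⟧ s []      = sym (·ᵥ-identityʳ ⟦ s ⟧)
  ⟦tileAt⟧ s (a ∷ w) = begin
    ⟦ tileAt (child s a) w ⟧     ≡⟨ ⟦tileAt⟧ (child s a) w ⟩
    ⟦ child s a ⟧ ·ᵥ ⟦ w ⟧*      ≡⟨ cong (_·ᵥ ⟦ w ⟧*) (⟦child⟧ s a) ⟩
    (⟦ s ⟧ ·ᵥ ⟦ a ⟧Σ) ·ᵥ ⟦ w ⟧*  ≡⟨ ·ᵥ-·ₘ-assoc ⟦ s ⟧ ⟦ a ⟧Σ ⟦ w ⟧* ⟨
    ⟦ s ⟧ ·ᵥ ⟦ a ∷ w ⟧*          ∎

mainTheorem14 : (p : ℕ) .{{_ : NonZero p}} → Prime p → ¬ (2 ∣ p) →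
    let open Field p in
    (k : ℕ) (s : Tile) (w : Vec Σ k) →
    ⟦ tileAt s w ⟧ ≡ ⟦ s ⟧ ·ᵥ ⟦ w ⟧*
mainTheorem14 p _ _ _ = Tiling.⟦tileAt⟧ p
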